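{- Let $G_1\le S_{n_1}$ and $G_2\le S_{n_2}$ be transitive nilpotent groups of coprime orders with $n_1,n_2>1$, and let $G=G_1\times G_2\le S_{n_1n_2}$ be their natural direct product. Then $$a(G)=\max\big(a(G_1)/n_2,\ a(G_2)/n_1\big),$$ and the two numbers in the maximum are different.
   Context: The natural direct product acts on $\{1,\ldots,n_1\}\times\{1,\ldots,n_2\}$ (identified with $\{1,\ldots,n_1n_2\}$) by $(g_1,g_2)(i,j)=(g_1(i),g_2(j))$. For a permutation group $G\le S_n$ and $g\in G$, $\mathrm{ind}(g):=n-(\text{number of orbits of }g)$, $\mathrm{ind}(G):=\min\{\mathrm{ind}(g):g\neq\mathrm{id}\}$, and $a(G):=\mathrm{ind}(G)^{ -1}$. -}

module Defs where

open import Data.Nat using (ℕ; zero; suc; _∸_; _<_; _≤_; _*_; NonZero)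
open import Data.Fin using (Fin; combine)
open import Data.Fin.Permutation using (Permutation′; _⟨$⟩ʳ_; _∘ₚ_; flip)
import Data.Fin.Permutation as P
open import Data.Integer using (+_)
open import Data.Rational using (ℚ; 0ℚ; _/_)
open import Data.List using (List; length)
open import Data.List.Relation.Unary.Any using (Any)
open import Data.List.Relation.Unary.AllPairs using (AllPairs)
open import Data.Vec using (Vec; lookup)
open import Data.Product using (Σ; ∃; _×_; _,_)
open import Relation.Binary.PropositionalEquality using (_≡_; _≢_)
open import Relation.Nullary using (¬_)
open import Function using (_∘_)

Perm : ℕ → Set
Perm n = Permutation′ n

_≈_ : ∀ {n} → Perm n → Perm n → Set
g ≈ h = ∀ i → g ⟨$⟩ʳ i ≡ h ⟨$⟩ʳ i

idP : ∀ {n} → Perm n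
idP = P.id

-- group product:  (g · h)(i) = g (h i)
_·_ : ∀ {n} → Perm n → Perm n → Perm n
g · h = h ∘ₚ g

_⁻¹ : ∀ {n} → Perm n → Perm n
g ⁻¹ = flip g

iter : ∀ {n} → Perm n → ℕ → Fin n → Fin n
iter g zero    i = i
iter g (suc k) i = g ⟨$⟩ʳ iter g k i

-- j lies in the ⟨g⟩-orbit of i  (for a permutation of a finite set,
-- the orbit of i under ⟨g⟩ is { g^k i : k ∈ ℕ })
SameOrbit : ∀ {n} → Perm n → Fin n → Fin n → Set
SameOrbit g i j = ∃ λ k → iter g k i ≡ j

NumOrbits : ∀ {n} → Perm n → ℕ → Set
NumOrbits {n} g m =
  Σ (Vec (Fin n) m) λ reps →
    (∀ (a b : Fin m) → SameOrbit g (lookup reps a) (lookup reps b) → a ≡ b)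
    × (∀ (i : Fin n) → ∃ λ (a : Fin m) → SameOrbit g (lookup reps a) i)

IndOf : ∀ {n} → Perm n → ℕ → Set
IndOf {n} g k = ∃ λ m → NumOrbits g m × k ≡ n ∸ m

PermSet : ℕ → Set₁
PermSet n = Perm n → Set

IsIndex : ∀ {n} → PermSet n → ℕ → Set
IsIndex H k =
  (∃ λ g → H g × ¬ (g ≈ idP) × IndOf g k)
  × (∀ g → H g → ¬ (g ≈ idP) → ∀ l → IndOf g l → k ≤ l)

-- 1/k as a rational (only used with k ≥ 1)
recip : ℕ → ℚ
recip zero    = 0ℚ
recip (suc k) = (+ 1) / suc k

IsA : ∀ {n} → PermSet n → ℚ → Set
IsA H q = ∃ λ k → IsIndex H k × q ≡ recip k

_∈L_ : ∀ {n} → Perm n → List (Perm n) → Set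
g ∈L xs = Any (g ≈_) xs

record PermGroup (n : ℕ) : Set where
  field
    elems    : List (Perm n)
    distinct : AllPairs (λ g h → ¬ (g ≈ h)) elems
    id-mem   : idP ∈L elems
    mul-mem  : ∀ g h → g ∈L elems → h ∈L elems → (g · h) ∈L elems
    inv-mem  : ∀ g → g ∈L elems → (g ⁻¹) ∈L elems

open PermGroup public

mem : ∀ {n} → PermGroup n → PermSet n
mem G g = g ∈L elems G

order : ∀ {n} → PermGroup n → ℕ
order G = length (elems G)

Transitive : ∀ {n} → PermGroup n → Set
Transitive {n} G = ∀ (i j : Fin n) → ∃ λ g → mem G g × g ⟨$⟩ʳ i ≡ j

IsSubgroupOf : ∀ {n} → PermSet n → PermGroup n → Set
IsSubgroupOf H G =
  (∀ g h → g ≈ h → H g → H h)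
  × (∀ g → H g → mem G g)
  × H idP
  × (∀ g h → H g → H h → H (g · h))
  × (∀ g → H g → H (g ⁻¹))

IsNormalIn : ∀ {n} → PermSet n → PermGroup n → Set
IsNormalIn H G = ∀ g h → mem G g → H h → H ((g · h) · (g ⁻¹))

commutator : ∀ {n} → Perm n → Perm n → Perm n
commutator g h = ((g ⁻¹) · (h ⁻¹)) · (g · h)

IsCentralSeries : ∀ {n} → PermGroup n → ℕ → (ℕ → PermSet n) → Set
IsCentralSeries G c Z =
  (∀ i → IsSubgroupOf (Z i) G)
  × (∀ i → IsNormalIn (Z i) G)
  × (∀ g → Z 0 g → g ≈ idP)
  × (∀ g → mem G g → Z c g)
  × (∀ i → i < c → ∀ g → Z i g → Z (suc i) g)
  × (∀ i → i < c → ∀ g z → mem G g → Z (suc i) z → Z i (commutator g z))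

Nilpotent : ∀ {n} → PermGroup n → Set₁
Nilpotent G = ∃ λ c → Σ (ℕ → PermSet _) λ Z → IsCentralSeries G c Z

-- Natural direct product G₁ × G₂ ≤ S_{n₁ n₂}, where (i , j) is
-- identified with combine i j = i·n₂ + j

DirectProduct : ∀ {n₁ n₂} → PermGroup n₁ → PermGroup n₂ → PermSet (n₁ * n₂)
DirectProduct {n₁} {n₂} G₁ G₂ σ =
  ∃ λ g₁ → ∃ λ g₂ → mem G₁ g₁ × mem G₂ g₂ ×
    (∀ (i : Fin n₁) (j : Fin n₂) →
       σ ⟨$⟩ʳ combine i j ≡ combine (g₁ ⟨$⟩ʳ i) (g₂ ⟨$⟩ʳ j))

{-# OPTIONS --safe #-}
module Submission where

-- An element σ = (g₁ , g₂) ≠ 1 of G₁ × G₂ with g₁ ≠ 1 has, over each orbit of g₁, at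
-- most n₂ orbits (σ is semiconjugate to g₁ by the first projection), so
-- ind σ ≥ n₂ · ind g₁ ≥ n₂ · ind(G₁); symmetrically ind σ ≥ n₁ · ind(G₂) when g₁ = 1.
-- Both bounds are attained, by (g₁ , 1) and (1 , g₂), since (g₁ , 1) has exactly n₂
-- orbits over each orbit of g₁. Hence ind(G) = min (n₂ ind(G₁)) (n₁ ind(G₂)).
-- By orbit–stabiliser nᵢ divides |Gᵢ|, so n₁ and n₂ are coprime, and
-- n₂ ind(G₁) = n₁ ind(G₂) would force n₁ ∣ ind(G₁), impossible as 0 < ind(G₁) < n₁.

open import Defs
open import Data.Nat using (ℕ; _<_)
open import Data.Nat.Coprimality using (Coprime)
open import Data.Rational using (ℚ; _*_; _⊔_)
open import Data.Product using (∃; _×_)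
open import Relation.Binary.PropositionalEquality using (_≡_; _≢_)

open import Data.Integer using (+_; +≤+)
open import Data.Fin as Fin using (Fin; toℕ; fromℕ<; combine; quotient; remainder)
import Data.Fin.Properties as FinP
open import Data.Fin.Permutation using (_⟨$⟩ʳ_; inverseˡ)
open import Data.List as List using (List; _∷_; filter; allFin)
import Data.List.Membership.Propositional.Properties as ∈P
import Data.List.Membership.Setoid.Properties as ∈ₛP
import Data.List.Relation.Unary.All as All
import Data.List.Relation.Unary.All.Properties as AllP
import Data.List.Relation.Unary.Any as Any
import Data.List.Relation.Unary.Any.Properties as AnyP
open import Data.List.Relation.Unary.AllPairs using (_∷_)
open import Data.List.Relation.Unary.Unique.Setoid using (Unique)
import Data.List.Relation.Unary.Unique.Propositional.Properties as UniqueP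
import Data.List.Relation.Unary.Unique.Setoid.Properties as UniqueₛP
import Data.Nat as ℕ
open import Data.Nat using (zero; suc; _+_; _∸_; _⊓_; z≤n; s≤s; z<s)
import Data.Nat.Properties as ℕP
open import Data.Nat.Coprimality using (1-coprimeTo; coprime-divisor)
open import Data.Nat.Divisibility using (_∣_; divides; m∣m*n; ∣-trans; ∣⇒≤)
open import Data.Nat.DivMod using (_%_; _/_; m≡m%n+[m/n]*n; m%n<n)
open import Data.Product using (Σ; ∃₂; _,_; proj₁; proj₂)
open import Data.Product.Function.NonDependent.Propositional using (_×-↔_)
import Data.Rational as ℚ
open import Data.Rational using (mkℚ; *≤*)
import Data.Rational.Properties as ℚP
import Data.Rational.Unnormalised as ℚᵘ
import Data.Rational.Unnormalised.Properties as ℚᵘP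
open import Data.Sum using (_⊎_; inj₁; inj₂)
open import Data.Vec using (Vec; lookup; tabulate)
open import Data.Vec.Properties using (lookup∘tabulate)
open import Function using (_∘_)
open import Function.Bundles using (Injection)
open import Function.Construct.Composition using (_↔-∘_)
open import Function.Construct.Symmetry using (↔-sym)
open import Function.Properties.Inverse using (↔⇒↣)
open import Level using (Level)
open import Relation.Binary using (Rel; Setoid; IsDecEquivalence; Decidable)
open import Relation.Binary.PropositionalEquality
open import Relation.Nullary using (Dec; yes; no; ¬_; contradiction)
open import Relation.Nullary.Decidable using (map′; _→-dec_)
open import Relation.Unary using (Pred)
import Relation.Unary as U

private
  variable
    ℓ : Level

lookup-injective : ∀ {a} (S : Setoid a ℓ) {xs} → Unique S xs →
  ∀ {i j} → Setoid._≈_ S (List.lookup xs i) (List.lookup xs j) → i ≡ j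
lookup-injective S {_ ∷ _}  (_   ∷ _) {Fin.zero}  {Fin.zero}  _ = refl
lookup-injective S {_ ∷ _}  (x∉ ∷ _) {Fin.zero}  {Fin.suc j} e = contradiction e (All.lookup x∉ (∈P.∈-lookup j))
lookup-injective S {_ ∷ _}  (x∉ ∷ _) {Fin.suc i} {Fin.zero}  e =
  contradiction (Setoid.sym S e) (All.lookup x∉ (∈P.∈-lookup i))
lookup-injective S {_ ∷ _}  (_ ∷ u)  {Fin.suc i} {Fin.suc j} e = cong Fin.suc (lookup-injective S u e)

least : ∀ {n} {P : Pred (Fin n) ℓ} → U.Decidable P → ∀ {i} → P i →
  ∃ λ j → P j × ∀ k → P k → j Fin.≤ k
least {n = suc n} P? {i} Pi with P? Fin.zero | i
... | yes P0 | _ = Fin.zero , P0 , λ _ _ → z≤n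
... | no ¬P0 | Fin.zero = contradiction Pi ¬P0
... | no ¬P0 | Fin.suc _ with least (P? ∘ Fin.suc) Pi
...   | j , Pj , j-least = Fin.suc j , Pj , λ
        { Fin.zero P0 → contradiction P0 ¬P0 ; (Fin.suc k) Pk → s≤s (j-least k Pk) }

module _ {n} {R : Rel (Fin n) ℓ} (isDecEquivalence : IsDecEquivalence R) where
  open IsDecEquivalence isDecEquivalence
    renaming (_≟_ to _R?_; refl to R-refl; sym to R-sym; trans to R-trans)

  Leftmost : Fin n → Set ℓ
  Leftmost i = ∀ j → R j i → i Fin.≤ j

  leftmost? : U.Decidable Leftmost
  leftmost? i = FinP.all? λ j → (j R? i) →-dec (i FinP.≤? j)

  leftmost-representative : ∀ i → ∃ λ j → R j i × Leftmost j
  leftmost-representative i with least (_R? i) (R-refl {i})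
  ... | j , Rji , j-least = j , Rji , λ k Rkj → j-least k (R-trans Rkj Rji)

  leftmost-unique : ∀ {i j} → Leftmost i → Leftmost j → R i j → i ≡ j
  leftmost-unique {i} {j} i-leftmost j-leftmost Rij =
    FinP.≤-antisym (i-leftmost j (R-sym Rij)) (j-leftmost i Rij)

  transversal : ∃ λ m → Σ (Vec (Fin n) m) λ reps →
    (∀ a b → R (lookup reps a) (lookup reps b) → a ≡ b) × (∀ i → ∃ λ a → R (lookup reps a) i)
  transversal = List.length leftmosts , reps , reps-distinct , reps-cover
    where
    leftmosts : List (Fin n)
    leftmosts = filter leftmost? (allFin n)

    reps : Vec (Fin n) (List.length leftmosts)
    reps = tabulate (List.lookup leftmosts)

    rep-leftmost : ∀ a → Leftmost (lookup reps a)
    rep-leftmost a rewrite lookup∘tabulate (List.lookup leftmosts) a =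
      All.lookup (AllP.all-filter leftmost? (allFin n)) (∈P.∈-lookup a)

    reps-distinct : ∀ a b → R (lookup reps a) (lookup reps b) → a ≡ b
    reps-distinct a b Rab = lookup-injective (setoid (Fin n)) (UniqueP.filter⁺ leftmost? (UniqueP.allFin⁺ n))
      (trans (sym (lookup∘tabulate (List.lookup leftmosts) a))
        (trans (leftmost-unique (rep-leftmost a) (rep-leftmost b) Rab) (lookup∘tabulate (List.lookup leftmosts) b)))

    reps-cover : ∀ i → ∃ λ a → R (lookup reps a) i
    reps-cover i with leftmost-representative i
    ... | j , Rji , j-leftmost = Any.index j∈leftmosts , subst (λ x → R x i) j≡rep Rji
      where
      j∈leftmosts : Any.Any (j ≡_) leftmosts
      j∈leftmosts = ∈P.∈-filter⁺ leftmost? (∈P.∈-allFin j) j-leftmost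
      j≡rep : j ≡ lookup reps (Any.index j∈leftmosts)
      j≡rep = trans (AnyP.lookup-index j∈leftmosts) (sym (lookup∘tabulate (List.lookup leftmosts) _))

⟨$⟩ʳ-injective : ∀ {n} (g : Perm n) {i j} → g ⟨$⟩ʳ i ≡ g ⟨$⟩ʳ j → i ≡ j
⟨$⟩ʳ-injective g = Injection.injective (↔⇒↣ g)

module _ {n} (g : Perm n) where

  iter-+ : ∀ a b i → iter g (a + b) i ≡ iter g a (iter g b i)
  iter-+ zero    b i = refl
  iter-+ (suc a) b i = cong (g ⟨$⟩ʳ_) (iter-+ a b i)

  iter-injective : ∀ k {i j} → iter g k i ≡ iter g k j → i ≡ j
  iter-injective zero    e = e
  iter-injective (suc k) e = iter-injective k (⟨$⟩ʳ-injective g e)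

  iter-*-period : ∀ {p i} → iter g p i ≡ i → ∀ c → iter g (c ℕ.* p) i ≡ i
  iter-*-period         gᵖi≡i zero    = refl
  iter-*-period {p} {i} gᵖi≡i (suc c) =
    trans (iter-+ p (c ℕ.* p) i) (trans (cong (iter g p) (iter-*-period gᵖi≡i c)) gᵖi≡i)

  iter-%-period : ∀ {p i} .{{_ : ℕ.NonZero p}} → iter g p i ≡ i → ∀ k → iter g (k % p) i ≡ iter g k i
  iter-%-period {p} {i} gᵖi≡i k = begin
    iter g (k % p) i                           ≡⟨ cong (iter g (k % p)) (sym (iter-*-period gᵖi≡i (k / p))) ⟩
    iter g (k % p) (iter g (k / p ℕ.* p) i)    ≡⟨ sym (iter-+ (k % p) (k / p ℕ.* p) i) ⟩
    iter g (k % p + k / p ℕ.* p) i             ≡⟨ cong (λ t → iter g t i) (sym (m≡m%n+[m/n]*n k p)) ⟩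
    iter g k i                                 ∎
    where open ≡-Reasoning

  period : ∀ i → ∃ λ p → 0 ℕ.< p × p ℕ.≤ n × iter g p i ≡ i
  period i with FinP.pigeonhole (ℕP.n<1+n n) (λ t → iter g (toℕ t) i)
  ... | a , b , a<b , gᵃi≡gᵇi = toℕ b ∸ toℕ a , ℕP.m<n⇒0<n∸m a<b , p≤n , iter-injective (toℕ a) gᵃgᵖi≡gᵃi
    where
    p≤n : toℕ b ∸ toℕ a ℕ.≤ n
    p≤n = ℕP.≤-trans (ℕP.m∸n≤m (toℕ b) (toℕ a)) (FinP.toℕ≤pred[n] b)
    gᵃgᵖi≡gᵃi : iter g (toℕ a) (iter g (toℕ b ∸ toℕ a) i) ≡ iter g (toℕ a) i
    gᵃgᵖi≡gᵃi = trans (sym (iter-+ (toℕ a) (toℕ b ∸ toℕ a) i))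
      (trans (cong (λ t → iter g t i) (ℕP.m+[n∸m]≡n (ℕP.<⇒≤ a<b))) (sym gᵃi≡gᵇi))

  SameOrbit-sym : ∀ {i j} → SameOrbit g i j → SameOrbit g j i
  SameOrbit-sym {i} {j} (k , gᵏi≡j) with period i
  ... | suc p , _ , _ , gᵖi≡i = p ℕ.* k , (begin
    iter g (p ℕ.* k) j               ≡⟨ cong (iter g (p ℕ.* k)) (sym gᵏi≡j) ⟩
    iter g (p ℕ.* k) (iter g k i)    ≡⟨ sym (iter-+ (p ℕ.* k) k i) ⟩
    iter g (p ℕ.* k + k) i           ≡⟨ cong (λ t → iter g t i) (trans (ℕP.+-comm (p ℕ.* k) k) (ℕP.*-comm (suc p) k)) ⟩
    iter g (k ℕ.* suc p) i           ≡⟨ iter-*-period gᵖi≡i k ⟩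
    i                                ∎)
    where open ≡-Reasoning

  SameOrbit-trans : ∀ {i j l} → SameOrbit g i j → SameOrbit g j l → SameOrbit g i l
  SameOrbit-trans {i} (a , gᵃi≡j) (b , gᵇj≡l) = b + a , trans (iter-+ b a i) (trans (cong (iter g b) gᵃi≡j) gᵇj≡l)

  SameOrbit-bounded : ∀ {i j} → SameOrbit g i j → ∃ λ (t : Fin (suc n)) → iter g (toℕ t) i ≡ j
  SameOrbit-bounded {i} (k , gᵏi≡j) with period i
  ... | suc p , _ , p≤n , gᵖi≡i = fromℕ< k%p<1+n ,
    trans (cong (λ t → iter g t i) (FinP.toℕ-fromℕ< k%p<1+n)) (trans (iter-%-period gᵖi≡i k) gᵏi≡j)
    where
    k%p<1+n : k % suc p ℕ.< suc n
    k%p<1+n = ℕP.<-≤-trans (m%n<n k (suc p)) (ℕP.m≤n⇒m≤1+n p≤n)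

  SameOrbit? : Decidable (SameOrbit g)
  SameOrbit? i j = map′ (λ (t , e) → toℕ t , e) SameOrbit-bounded
    (FinP.any? λ t → iter g (toℕ t) i FinP.≟ j)

  SameOrbit-isDecEquivalence : IsDecEquivalence (SameOrbit g)
  SameOrbit-isDecEquivalence = record
    { isEquivalence = record { refl = 0 , refl ; sym = SameOrbit-sym ; trans = SameOrbit-trans }
    ; _≟_ = SameOrbit?
    }

  numOrbits : ∃ (NumOrbits g)
  numOrbits = transversal SameOrbit-isDecEquivalence

numOrbits-pos : ∀ {n} {g : Perm n} {m} → NumOrbits g m → Fin n → 0 ℕ.< m
numOrbits-pos {m = zero}  (_ , _ , cover) i with () ← proj₁ (cover i)
numOrbits-pos {m = suc _} _               _ = z<s

-- If the moved point i is a representative, then g i lies in its orbit and is not one.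
missed-point : ∀ {n} {g : Perm n} {m} (orbits : NumOrbits g m) → ¬ (g ≈ idP) →
  ∃ λ x → ∀ a → lookup (proj₁ orbits) a ≢ x
missed-point {n} {g} (reps , reps-distinct , _) g≉id
  with FinP.¬∀⟶∃¬ n (λ i → g ⟨$⟩ʳ i ≡ i) (λ i → g ⟨$⟩ʳ i FinP.≟ i) g≉id
... | i , gi≢i with FinP.any? (λ a → lookup reps a FinP.≟ i)
...   | no i∉reps = i , λ a e → i∉reps (a , e)
...   | yes (a , repa≡i) = g ⟨$⟩ʳ i , λ b repb≡gi →
  gi≢i (trans (sym repb≡gi) (trans (cong (lookup reps)
    (sym (reps-distinct a b (1 , trans (cong (g ⟨$⟩ʳ_) repa≡i) (sym repb≡gi))))) repa≡i))

numOrbits-< : ∀ {n} {g : Perm n} {m} → NumOrbits g m → ¬ (g ≈ idP) → m ℕ.< n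
numOrbits-< {zero}          _      g≉id = contradiction (λ ()) g≉id
numOrbits-< {suc n} {g} {m} orbits g≉id with missed-point orbits g≉id
... | x , x∉reps = s≤s (FinP.injective⇒≤ avoid-injective)
  where
  avoid : Fin m → Fin n
  avoid a = Fin.punchOut (x∉reps a ∘ sym)

  avoid-injective : ∀ {a b} → avoid a ≡ avoid b → a ≡ b
  avoid-injective {a} {b} e =
    proj₁ (proj₂ orbits) a b (0 , FinP.punchOut-injective (x∉reps a ∘ sym) (x∉reps b ∘ sym) e)

module _ {N n k} {g : Perm N} {h : Perm n} (p : Fin N → Fin n) (q : Fin N → Fin k)
  (pq-injective : ∀ {x y} → p x ≡ p y → q x ≡ q y → x ≡ y)
  (p-semiconj : ∀ x → p (g ⟨$⟩ʳ x) ≡ h ⟨$⟩ʳ p x) where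

  iter-semiconj : ∀ t x → p (iter g t x) ≡ iter h t (p x)
  iter-semiconj zero    x = refl
  iter-semiconj (suc t) x = trans (p-semiconj (iter g t x)) (cong (h ⟨$⟩ʳ_) (iter-semiconj t x))

  -- A g-orbit is sent into one h-orbit, and q separates the points of each fibre of p.
  numOrbits-≤-semiconj : ∀ {m m′} → NumOrbits g m → NumOrbits h m′ → m ℕ.≤ m′ ℕ.* k
  numOrbits-≤-semiconj {m} {m′} (reps , reps-distinct , _) (reps′ , _ , reps′-cover) =
    FinP.injective⇒≤ label-injective
    where
    landing : ∀ x → ∃₂ λ a t → p (iter g t x) ≡ lookup reps′ a
    landing x with reps′-cover (p x)
    ... | a , orbit with SameOrbit-sym h orbit
    ...   | t , hᵗpx≡rep = a , t , trans (iter-semiconj t x) hᵗpx≡rep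

    target : Fin m → Fin m′
    target b = proj₁ (landing (lookup reps b))

    time : Fin m → ℕ
    time b = proj₁ (proj₂ (landing (lookup reps b)))

    lands : ∀ b → p (iter g (time b) (lookup reps b)) ≡ lookup reps′ (target b)
    lands b = proj₂ (proj₂ (landing (lookup reps b)))

    label : Fin m → Fin (m′ ℕ.* k)
    label b = combine (target b) (q (iter g (time b) (lookup reps b)))

    label-injective : ∀ {b b′} → label b ≡ label b′ → b ≡ b′
    label-injective {b} {b′} e with FinP.combine-injective (target b) _ (target b′) _ e
    ... | target≡ , q≡ =
      reps-distinct b b′ (SameOrbit-trans g (time b , same-point) (SameOrbit-sym g (time b′ , refl)))
      where
      same-point : iter g (time b) (lookup reps b) ≡ iter g (time b′) (lookup reps b′)
      same-point = pq-injective (trans (lands b) (trans (cong (lookup reps′) target≡) (sym (lands b′)))) q≡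

module _ {N n k} {g : Perm N} {h : Perm n} (e : Fin n → Fin k → Fin N)
  (e-injective : ∀ {i j i′ j′} → e i j ≡ e i′ j′ → i ≡ i′ × j ≡ j′)
  (e-equivariant : ∀ i j → g ⟨$⟩ʳ e i j ≡ e (h ⟨$⟩ʳ i) j) where

  iter-equivariant : ∀ t i j → iter g t (e i j) ≡ e (iter h t i) j
  iter-equivariant zero    i j = refl
  iter-equivariant (suc t) i j = trans (cong (g ⟨$⟩ʳ_) (iter-equivariant t i j)) (e-equivariant (iter h t i) j)

  numOrbits-≥-copies : ∀ {m m′} → NumOrbits g m → NumOrbits h m′ → m′ ℕ.* k ℕ.≤ m
  numOrbits-≥-copies {m} {m′} (reps , _ , reps-cover) (reps′ , reps′-distinct , _) =
    FinP.injective⇒≤ orbit-injective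
    where
    point : Fin (m′ ℕ.* k) → Fin N
    point c = e (lookup reps′ (quotient k c)) (remainder {m′} k c)

    orbit : Fin (m′ ℕ.* k) → Fin m
    orbit c = proj₁ (reps-cover (point c))

    orbit-injective : ∀ {c c′} → orbit c ≡ orbit c′ → c ≡ c′
    orbit-injective {c} {c′} e≡ with SameOrbit-trans g (SameOrbit-sym g (proj₂ (reps-cover (point c))))
      (subst (λ a → SameOrbit g (lookup reps a) (point c′)) (sym e≡) (proj₂ (reps-cover (point c′))))
    ... | t , gᵗc≡c′ with e-injective (trans (sym (iter-equivariant t _ _)) gᵗc≡c′)
    ...   | hᵗ , same-copy = trans (sym (FinP.combine-remQuot {m′} k c))
      (trans (cong₂ combine (reps′-distinct _ _ (t , hᵗ)) same-copy) (FinP.combine-remQuot {m′} k c′))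

module _ {n₁ n₂ : ℕ} where

  quotient-combine : ∀ (i : Fin n₁) (j : Fin n₂) → quotient {n₁} n₂ (combine i j) ≡ i
  quotient-combine i j = cong proj₁ (FinP.remQuot-combine i j)

  remainder-combine : ∀ (i : Fin n₁) (j : Fin n₂) → remainder {n₁} n₂ (combine i j) ≡ j
  remainder-combine i j = cong proj₂ (FinP.remQuot-combine i j)

  quotient-remainder-injective : ∀ {x y : Fin (n₁ ℕ.* n₂)} →
    quotient {n₁} n₂ x ≡ quotient {n₁} n₂ y → remainder {n₁} n₂ x ≡ remainder {n₁} n₂ y → x ≡ y
  quotient-remainder-injective {x} {y} q≡ r≡ =
    trans (sym (FinP.combine-remQuot {n₁} n₂ x)) (trans (cong₂ combine q≡ r≡) (FinP.combine-remQuot {n₁} n₂ y))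

  infix 25 _⊗_
  _⊗_ : Perm n₁ → Perm n₂ → Perm (n₁ ℕ.* n₂)
  g₁ ⊗ g₂ = ↔-sym FinP.*↔× ↔-∘ ((g₁ ×-↔ g₂) ↔-∘ FinP.*↔×)

  ⊗-combine : ∀ g₁ g₂ i j → (g₁ ⊗ g₂) ⟨$⟩ʳ combine i j ≡ combine (g₁ ⟨$⟩ʳ i) (g₂ ⟨$⟩ʳ j)
  ⊗-combine g₁ g₂ i j =
    cong₂ combine (cong (g₁ ⟨$⟩ʳ_) (quotient-combine i j)) (cong (g₂ ⟨$⟩ʳ_) (remainder-combine i j))

module ProductAction {n₁ n₂} {σ : Perm (n₁ ℕ.* n₂)} {g₁ : Perm n₁} {g₂ : Perm n₂}
  (σ-combine : ∀ i j → σ ⟨$⟩ʳ combine i j ≡ combine (g₁ ⟨$⟩ʳ i) (g₂ ⟨$⟩ʳ j)) where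

  σ-remQuot : ∀ x → σ ⟨$⟩ʳ x ≡ combine (g₁ ⟨$⟩ʳ quotient {n₁} n₂ x) (g₂ ⟨$⟩ʳ remainder {n₁} n₂ x)
  σ-remQuot x = trans (cong (σ ⟨$⟩ʳ_) (sym (FinP.combine-remQuot {n₁} n₂ x))) (σ-combine _ _)

  σ-quotient : ∀ x → quotient {n₁} n₂ (σ ⟨$⟩ʳ x) ≡ g₁ ⟨$⟩ʳ quotient {n₁} n₂ x
  σ-quotient x = trans (cong (quotient {n₁} n₂) (σ-remQuot x)) (quotient-combine (g₁ ⟨$⟩ʳ _) (g₂ ⟨$⟩ʳ _))

  σ-remainder : ∀ x → remainder {n₁} n₂ (σ ⟨$⟩ʳ x) ≡ g₂ ⟨$⟩ʳ remainder {n₁} n₂ x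
  σ-remainder x = trans (cong (remainder {n₁} n₂) (σ-remQuot x)) (remainder-combine (g₁ ⟨$⟩ʳ _) (g₂ ⟨$⟩ʳ _))

  σ≈idP : g₁ ≈ idP → g₂ ≈ idP → σ ≈ idP
  σ≈idP g₁≈id g₂≈id x =
    trans (σ-remQuot x) (trans (cong₂ combine (g₁≈id _) (g₂≈id _)) (FinP.combine-remQuot {n₁} n₂ x))

  σ≈idP⇒g₁≈idP : Fin n₂ → σ ≈ idP → g₁ ≈ idP
  σ≈idP⇒g₁≈idP j σ≈id i = proj₁ (FinP.combine-injective (g₁ ⟨$⟩ʳ i) (g₂ ⟨$⟩ʳ j) i j (trans (sym (σ-combine i j)) (σ≈id _)))

  σ≈idP⇒g₂≈idP : Fin n₁ → σ ≈ idP → g₂ ≈ idP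
  σ≈idP⇒g₂≈idP i σ≈id j = proj₂ (FinP.combine-injective (g₁ ⟨$⟩ʳ i) (g₂ ⟨$⟩ʳ j) i j (trans (sym (σ-combine i j)) (σ≈id _)))

  numOrbits-≤ˡ : ∀ {m m₁} → NumOrbits σ m → NumOrbits g₁ m₁ → m ℕ.≤ m₁ ℕ.* n₂
  numOrbits-≤ˡ = numOrbits-≤-semiconj (quotient n₂) (remainder {n₁} n₂)
    quotient-remainder-injective σ-quotient

  numOrbits-≤ʳ : ∀ {m m₂} → NumOrbits σ m → NumOrbits g₂ m₂ → m ℕ.≤ m₂ ℕ.* n₁
  numOrbits-≤ʳ = numOrbits-≤-semiconj (remainder {n₁} n₂) (quotient n₂)
    (λ r≡ q≡ → quotient-remainder-injective q≡ r≡) σ-remainder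

  numOrbits-≥ˡ : g₂ ≈ idP → ∀ {m m₁} → NumOrbits σ m → NumOrbits g₁ m₁ → m₁ ℕ.* n₂ ℕ.≤ m
  numOrbits-≥ˡ g₂≈id = numOrbits-≥-copies combine (λ {i} {j} {i′} {j′} → FinP.combine-injective i j i′ j′)
    (λ i j → trans (σ-combine i j) (cong (combine (g₁ ⟨$⟩ʳ i)) (g₂≈id j)))

  numOrbits-≥ʳ : g₁ ≈ idP → ∀ {m m₂} → NumOrbits σ m → NumOrbits g₂ m₂ → m₂ ℕ.* n₁ ℕ.≤ m
  numOrbits-≥ʳ g₁≈id = numOrbits-≥-copies (λ j i → combine i j)
    (λ {j} {i} {j′} {i′} e → let (i≡ , j≡) = FinP.combine-injective i j i′ j′ e in j≡ , i≡)
    (λ j i → trans (σ-combine i j) (cong (λ i′ → combine i′ _) (g₁≈id i)))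

Perm-setoid : ℕ → Setoid _ _
Perm-setoid n = record
  { Carrier       = Perm n
  ; _≈_           = _≈_
  ; isEquivalence = record
    { refl  = λ _ → refl
    ; sym   = λ g≈h i → sym (g≈h i)
    ; trans = λ g≈h h≈k i → trans (g≈h i) (h≈k i)
    }
  }

·-cancelˡ : ∀ {n} (t : Perm n) {g h} → (t · g) ≈ (t · h) → g ≈ h
·-cancelˡ t tg≈th i = ⟨$⟩ʳ-injective t (tg≈th i)

-- Orbit–stabiliser by two injections: (j , h) ↦ tⱼ h from Fin n × Stab(o) into G, and
-- g ↦ (g o , t_{g o}⁻¹ g) back, where tⱼ ∈ G is chosen with tⱼ o = j by transitivity.
module _ {n} (G : PermGroup n) (transitive : Transitive G) (o : Fin n) where

  fixes? : ∀ g → Dec (g ⟨$⟩ʳ o ≡ o)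
  fixes? g = g ⟨$⟩ʳ o FinP.≟ o

  stabiliser : List (Perm n)
  stabiliser = filter fixes? (elems G)

  private
    s : ℕ
    s = List.length stabiliser

    resp-fixes : ∀ {g h : Perm n} → g ≈ h → g ⟨$⟩ʳ o ≡ o → h ⟨$⟩ʳ o ≡ o
    resp-fixes g≈h go≡o = trans (sym (g≈h o)) go≡o

    ∈-stabiliser⁺ : ∀ {g} → mem G g → g ⟨$⟩ʳ o ≡ o → Any.Any (g ≈_) stabiliser
    ∈-stabiliser⁺ {g} = ∈ₛP.∈-filter⁺ (Perm-setoid n) fixes? (λ {g} {h} → resp-fixes {g} {h}) {g} {elems G}

    stabiliser-unique : Unique (Perm-setoid n) stabiliser
    stabiliser-unique = UniqueₛP.filter⁺ (Perm-setoid n) fixes? (distinct G)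

    stabiliser-element : (b : Fin s) → mem G (List.lookup stabiliser b) × List.lookup stabiliser b ⟨$⟩ʳ o ≡ o
    stabiliser-element b = ∈ₛP.∈-filter⁻ (Perm-setoid n) fixes? (λ {g} {h} → resp-fixes {g} {h})
      {List.lookup stabiliser b} {elems G} (∈ₛP.∈-lookup (Perm-setoid n) stabiliser b)

    t : Fin n → Perm n
    t j = proj₁ (transitive o j)

    t∈G : ∀ j → mem G (t j)
    t∈G j = proj₁ (proj₂ (transitive o j))

    t-o : ∀ j → t j ⟨$⟩ʳ o ≡ j
    t-o j = proj₂ (proj₂ (transitive o j))

    t-lands : ∀ j b → (t j · List.lookup stabiliser b) ⟨$⟩ʳ o ≡ j
    t-lands j b = trans (cong (t j ⟨$⟩ʳ_) (proj₂ (stabiliser-element b))) (t-o j)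

    translate-mem : ∀ j b → mem G (t j · List.lookup stabiliser b)
    translate-mem j b = mul-mem G (t j) (List.lookup stabiliser b) (t∈G j) (proj₁ (stabiliser-element b))

    translate : Fin n → Fin s → Fin (order G)
    translate j b = Any.index (translate-mem j b)

    translate-injective : ∀ {j j′ b b′} → translate j b ≡ translate j′ b′ → j ≡ j′ × b ≡ b′
    translate-injective {j} {j′} {b} {b′} e = j≡j′ , b≡b′
      where
      same : (t j · List.lookup stabiliser b) ≈ (t j′ · List.lookup stabiliser b′)
      same = ∈ₛP.index-injective (Perm-setoid n)
        {t j · List.lookup stabiliser b} {t j′ · List.lookup stabiliser b′} {elems G} (translate-mem j b) (translate-mem j′ b′) e
      j≡j′ : j ≡ j′
      j≡j′ = trans (sym (t-lands j b)) (trans (same o) (t-lands j′ b′))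
      b≡b′ : b ≡ b′
      b≡b′ = lookup-injective (Perm-setoid n) stabiliser-unique (·-cancelˡ (t j) {List.lookup stabiliser b} {List.lookup stabiliser b′}
        (subst (λ k → (t j · List.lookup stabiliser b) ≈ (t k · List.lookup stabiliser b′)) (sym j≡j′) same))

    untranslated : Perm n → Perm n
    untranslated g = (t (g ⟨$⟩ʳ o) ⁻¹) · g

    untranslated-fixes : ∀ g → untranslated g ⟨$⟩ʳ o ≡ o
    untranslated-fixes g = trans (cong (t (g ⟨$⟩ʳ o) ⁻¹ ⟨$⟩ʳ_) (sym (t-o (g ⟨$⟩ʳ o)))) (inverseˡ (t (g ⟨$⟩ʳ o)))

    untranslated-mem : ∀ a → Any.Any (untranslated (List.lookup (elems G) a) ≈_) stabiliser
    untranslated-mem a = ∈-stabiliser⁺ {untranslated g}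
      (mul-mem G (t (g ⟨$⟩ʳ o) ⁻¹) g (inv-mem G (t (g ⟨$⟩ʳ o)) (t∈G (g ⟨$⟩ʳ o))) (∈ₛP.∈-lookup (Perm-setoid n) (elems G) a))
      (untranslated-fixes g)
      where
      g : Perm n
      g = List.lookup (elems G) a

    untranslate : Fin (order G) → Fin (n ℕ.* s)
    untranslate a = combine (List.lookup (elems G) a ⟨$⟩ʳ o) (Any.index (untranslated-mem a))

    untranslate-injective : ∀ {a a′} → untranslate a ≡ untranslate a′ → a ≡ a′
    untranslate-injective {a} {a′} e = lookup-injective (Perm-setoid n) (distinct G) {a} {a′}
      (·-cancelˡ (t (g ⟨$⟩ʳ o) ⁻¹) {g} {g′}
        (subst (λ k → untranslated g ≈ ((t k ⁻¹) · g′)) (sym go≡g′o) same))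
      where
      g g′ : Perm n
      g = List.lookup (elems G) a
      g′ = List.lookup (elems G) a′
      go≡g′o : g ⟨$⟩ʳ o ≡ g′ ⟨$⟩ʳ o
      go≡g′o = proj₁ (FinP.combine-injective (g ⟨$⟩ʳ o) _ (g′ ⟨$⟩ʳ o) _ e)
      same : untranslated g ≈ untranslated g′
      same = ∈ₛP.index-injective (Perm-setoid n) {untranslated g} {untranslated g′} {stabiliser}
        (untranslated-mem a) (untranslated-mem a′) (proj₂ (FinP.combine-injective (g ⟨$⟩ʳ o) _ (g′ ⟨$⟩ʳ o) _ e))

    translate′ : Fin (n ℕ.* s) → Fin (order G)
    translate′ c = translate (quotient s c) (remainder {n} s c)

    translate′-injective : ∀ {c c′} → translate′ c ≡ translate′ c′ → c ≡ c′
    translate′-injective e = let (j≡ , b≡) = translate-injective e in quotient-remainder-injective j≡ b≡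

  order-stabiliser : order G ≡ n ℕ.* s
  order-stabiliser = ℕP.≤-antisym (FinP.injective⇒≤ untranslate-injective) (FinP.injective⇒≤ translate′-injective)

transitive⇒∣order : ∀ {n} (G : PermGroup n) → Transitive G → Fin n → n ∣ order G
transitive⇒∣order {n} G transitive o = subst (n ∣_) (sym (order-stabiliser G transitive o)) (m∣m*n _)

≈idP? : ∀ {n} (g : Perm n) → Dec (g ≈ idP)
≈idP? g = FinP.all? λ i → g ⟨$⟩ʳ i FinP.≟ i

∸-*-≤ : ∀ n c {m} m′ → m ℕ.≤ m′ ℕ.* c → (n ∸ m′) ℕ.* c ℕ.≤ n ℕ.* c ∸ m
∸-*-≤ n c m′ m≤m′c = ℕP.≤-trans (ℕP.≤-reflexive (ℕP.*-distribʳ-∸ c n m′)) (ℕP.∸-monoʳ-≤ (n ℕ.* c) m≤m′c)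

IndOf-* : ∀ n c m′ {N} {σ : Perm N} → N ≡ n ℕ.* c → (∀ {m} → NumOrbits σ m → m ≡ m′ ℕ.* c) →
  IndOf σ ((n ∸ m′) ℕ.* c)
IndOf-* n c m′ {σ = σ} refl count =
  let (m , σ-orbits) = numOrbits σ
  in m , σ-orbits , trans (ℕP.*-distribʳ-∸ c n m′) (cong (n ℕ.* c ∸_) (sym (count σ-orbits)))

index-pos : ∀ {n} {H : PermSet n} {k} → IsIndex H k → 0 ℕ.< k
index-pos ((_ , _ , g≉id , _ , g-orbits , refl) , _) = ℕP.m<n⇒0<n∸m (numOrbits-< g-orbits g≉id)

index-< : ∀ {n} {H : PermSet n} {k} → IsIndex H k → Fin n → k ℕ.< n
index-< ((_ , _ , g≉id , _ , g-orbits , refl) , _) i =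
  ℕP.∸-monoʳ-< (numOrbits-pos g-orbits i) (ℕP.<⇒≤ (numOrbits-< g-orbits g≉id))

index-≤ : ∀ {n} {H : PermSet n} {k g m} → IsIndex H k → H g → ¬ (g ≈ idP) → NumOrbits g m → k ℕ.≤ n ∸ m
index-≤ {g = g} {m} (_ , minimal) g∈G g≉id g-orbits = minimal g g∈G g≉id _ (m , g-orbits , refl)

IndexAttained : ∀ {n} → PermSet n → ℕ → Set
IndexAttained H k = ∃ λ g → H g × ¬ (g ≈ idP) × IndOf g k

module _ {n₁ n₂} (G₁ : PermGroup n₁) (G₂ : PermGroup n₂) {k₁ k₂}
  (index₁ : IsIndex (mem G₁) k₁) (index₂ : IsIndex (mem G₂) k₂) where

  directProduct-ind-≥ : ∀ σ → DirectProduct G₁ G₂ σ → ¬ (σ ≈ idP) → ∀ l → IndOf σ l →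
    k₁ ℕ.* n₂ ℕ.≤ l ⊎ k₂ ℕ.* n₁ ℕ.≤ l
  directProduct-ind-≥ σ (g₁ , g₂ , g₁∈G₁ , g₂∈G₂ , σ-combine) σ≉id l (m , σ-orbits , refl)
    with ≈idP? g₁ | numOrbits g₁ | numOrbits g₂
  ... | no g₁≉id | m₁ , g₁-orbits | _ = inj₁ (ℕP.≤-trans (ℕP.*-monoˡ-≤ n₂ (index-≤ {g = g₁} index₁ g₁∈G₁ g₁≉id g₁-orbits))
          (∸-*-≤ n₁ n₂ m₁ (numOrbits-≤ˡ σ-orbits g₁-orbits)))
    where open ProductAction {σ = σ} {g₁} {g₂} σ-combine
  ... | yes g₁≈id | _ | m₂ , g₂-orbits = inj₂ (ℕP.≤-trans (ℕP.*-monoˡ-≤ n₁ (index-≤ {g = g₂} index₂ g₂∈G₂ g₂≉id g₂-orbits))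
          (subst (λ N → (n₂ ∸ m₂) ℕ.* n₁ ℕ.≤ N ∸ m) (ℕP.*-comm n₂ n₁)
            (∸-*-≤ n₂ n₁ m₂ (numOrbits-≤ʳ σ-orbits g₂-orbits))))
    where
    open ProductAction {σ = σ} {g₁} {g₂} σ-combine
    g₂≉id : ¬ (g₂ ≈ idP)
    g₂≉id g₂≈id = σ≉id (σ≈idP g₁≈id g₂≈id)

  directProduct-attainedˡ : Fin n₂ → IndexAttained (DirectProduct G₁ G₂) (k₁ ℕ.* n₂)
  directProduct-attainedˡ j with proj₁ index₁
  ... | g₁ , g₁∈G₁ , g₁≉id , m₁ , g₁-orbits , k₁≡ =
    g₁ ⊗ idP , (g₁ , idP , g₁∈G₁ , id-mem G₂ , ⊗-combine g₁ idP) , σ≉id ,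
    subst (λ k → IndOf (g₁ ⊗ idP) (k ℕ.* n₂)) (sym k₁≡) (IndOf-* n₁ n₂ m₁ refl λ σ-orbits →
      ℕP.≤-antisym (numOrbits-≤ˡ σ-orbits g₁-orbits) (numOrbits-≥ˡ (λ _ → refl) σ-orbits g₁-orbits))
    where
    open ProductAction {σ = g₁ ⊗ idP} {g₁} {idP} (⊗-combine g₁ idP)
    σ≉id : ¬ (g₁ ⊗ idP ≈ idP)
    σ≉id = g₁≉id ∘ σ≈idP⇒g₁≈idP j

  directProduct-attainedʳ : Fin n₁ → IndexAttained (DirectProduct G₁ G₂) (k₂ ℕ.* n₁)
  directProduct-attainedʳ i with proj₁ index₂
  ... | g₂ , g₂∈G₂ , g₂≉id , m₂ , g₂-orbits , k₂≡ =
    idP {n₁} ⊗ g₂ , (idP , g₂ , id-mem G₁ , g₂∈G₂ , ⊗-combine (idP {n₁}) g₂) , σ≉id ,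
    subst (λ k → IndOf (idP {n₁} ⊗ g₂) (k ℕ.* n₁)) (sym k₂≡) (IndOf-* n₂ n₁ m₂ (ℕP.*-comm n₁ n₂) λ σ-orbits →
      ℕP.≤-antisym (numOrbits-≤ʳ σ-orbits g₂-orbits) (numOrbits-≥ʳ (λ _ → refl) σ-orbits g₂-orbits))
    where
    open ProductAction {σ = idP {n₁} ⊗ g₂} {idP {n₁}} {g₂} (⊗-combine (idP {n₁}) g₂)
    σ≉id : ¬ (idP {n₁} ⊗ g₂ ≈ idP)
    σ≉id = g₂≉id ∘ σ≈idP⇒g₂≈idP i

  directProduct-index : Fin n₁ → Fin n₂ → IsIndex (DirectProduct G₁ G₂) ((k₁ ℕ.* n₂) ⊓ (k₂ ℕ.* n₁))
  directProduct-index i j = attained , minimal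
    where
    attained : IndexAttained (DirectProduct G₁ G₂) ((k₁ ℕ.* n₂) ⊓ (k₂ ℕ.* n₁))
    attained with ℕP.≤-total (k₁ ℕ.* n₂) (k₂ ℕ.* n₁)
    ... | inj₁ ≤ rewrite ℕP.m≤n⇒m⊓n≡m ≤ = directProduct-attainedˡ j
    ... | inj₂ ≥ rewrite ℕP.m≥n⇒m⊓n≡n ≥ = directProduct-attainedʳ i

    minimal : ∀ σ → DirectProduct G₁ G₂ σ → ¬ (σ ≈ idP) → ∀ l → IndOf σ l → (k₁ ℕ.* n₂) ⊓ (k₂ ℕ.* n₁) ℕ.≤ l
    minimal σ σ∈G σ≉id l σ-ind with directProduct-ind-≥ σ σ∈G σ≉id l σ-ind
    ... | inj₁ ≤l = ℕP.≤-trans (ℕP.m⊓n≤m _ _) ≤l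
    ... | inj₂ ≤l = ℕP.≤-trans (ℕP.m⊓n≤n _ _) ≤l

recip-suc : ∀ k → recip (suc k) ≡ mkℚ (+ 1) k (1-coprimeTo (suc k))
recip-suc k = ℚP.normalize-coprime (1-coprimeTo (suc k))

recip-* : ∀ m n → recip m ℚ.* recip n ≡ recip (m ℕ.* n)
recip-* zero    n       = ℚP.*-zeroˡ (recip n)
recip-* (suc m) zero    rewrite ℕP.*-zeroʳ m = ℚP.*-zeroʳ (recip (suc m))
recip-* (suc m) (suc n) = ℚP.toℚᵘ-injective (ℚᵘP.≃-trans
    (ℚP.toℚᵘ-homo-* (recip (suc m)) (recip (suc n))) unnormalised)
  where
  unnormalised : ℚ.toℚᵘ (recip (suc m)) ℚᵘ.* ℚ.toℚᵘ (recip (suc n)) ℚᵘ.≃ ℚ.toℚᵘ (recip (suc m ℕ.* suc n))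
  unnormalised rewrite recip-suc m | recip-suc n | recip-suc (n ℕ.+ m ℕ.* suc n) = ℚᵘ.*≡* refl

recip-injective : ∀ {m n} → recip m ≡ recip n → m ≡ n
recip-injective {zero}  {zero}  _ = refl
recip-injective {zero}  {suc n} e rewrite recip-suc n with () ← cong ℚ.numerator e
recip-injective {suc m} {zero}  e rewrite recip-suc m with () ← cong ℚ.numerator e
recip-injective {suc m} {suc n} e rewrite recip-suc m | recip-suc n = cong suc (cong ℚ.denominator-1 e)

recip-antitone : ∀ {m n} → 0 ℕ.< m → m ℕ.≤ n → recip n ℚ.≤ recip m
recip-antitone {suc m} {suc n} _ (s≤s m≤n) rewrite recip-suc m | recip-suc n =
  *≤* (+≤+ (s≤s (ℕP.+-monoˡ-≤ 0 m≤n)))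

recip-⊓ : ∀ {m n} → 0 ℕ.< m → 0 ℕ.< n → recip (m ⊓ n) ≡ recip m ⊔ recip n
recip-⊓ {m} {n} 0<m 0<n with ℕP.≤-total m n
... | inj₁ m≤n rewrite ℕP.m≤n⇒m⊓n≡m m≤n = sym (ℚP.p≥q⇒p⊔q≡p (recip-antitone 0<m m≤n))
... | inj₂ n≤m rewrite ℕP.m≥n⇒m⊓n≡n n≤m = sym (ℚP.p≤q⇒p⊔q≡q (recip-antitone 0<n n≤m))

coprime-∣ : ∀ {a b c d} → Coprime a b → c ∣ a → d ∣ b → Coprime c d
coprime-∣ coprime c∣a d∣b (e∣c , e∣d) = coprime (∣-trans e∣c c∣a , ∣-trans e∣d d∣b)

*-cross-≢ : ∀ {n₁ n₂ k₁} k₂ → Coprime n₁ n₂ → 0 ℕ.< k₁ → k₁ ℕ.< n₁ → k₁ ℕ.* n₂ ≢ k₂ ℕ.* n₁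
*-cross-≢ {n₁} {n₂} {suc k₁} k₂ coprime _ k₁<n₁ e =
  ℕP.<⇒≱ k₁<n₁ (∣⇒≤ (coprime-divisor coprime (divides k₂ (trans (ℕP.*-comm n₂ (suc k₁)) e))))

point : ∀ {n} → 1 < n → Fin n
point {suc _} _ = Fin.zero

lemma5p1 : ∀ {n₁ n₂ : ℕ} (G₁ : PermGroup n₁) (G₂ : PermGroup n₂) →
    1 < n₁ → 1 < n₂ →
    Transitive G₁ → Transitive G₂ →
    Nilpotent G₁ → Nilpotent G₂ →
    Coprime (order G₁) (order G₂) →
    ∀ (a₁ a₂ : ℚ) → IsA (mem G₁) a₁ → IsA (mem G₂) a₂ →
    ∃ λ (a : ℚ) → IsA (DirectProduct G₁ G₂) a
    × a ≡ ((a₁ * recip n₂) ⊔ (a₂ * recip n₁))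
    × (a₁ * recip n₂) ≢ (a₂ * recip n₁)
lemma5p1 {n₁} {n₂} G₁ G₂ 1<n₁ 1<n₂ transitive₁ transitive₂ _ _ coprime
  _ _ (k₁ , index₁ , refl) (k₂ , index₂ , refl) =
  recip ((k₁ ℕ.* n₂) ⊓ (k₂ ℕ.* n₁)) , (_ , directProduct-index G₁ G₂ index₁ index₂ i j , refl) ,
  value , different
  where
  i : Fin n₁
  i = point 1<n₁
  j : Fin n₂
  j = point 1<n₂

  value : recip ((k₁ ℕ.* n₂) ⊓ (k₂ ℕ.* n₁)) ≡ (recip k₁ * recip n₂) ⊔ (recip k₂ * recip n₁)
  value = begin
    recip ((k₁ ℕ.* n₂) ⊓ (k₂ ℕ.* n₁))              ≡⟨ recip-⊓ (positive index₁ 1<n₂) (positive index₂ 1<n₁) ⟩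
    recip (k₁ ℕ.* n₂) ⊔ recip (k₂ ℕ.* n₁)           ≡⟨ sym (cong₂ _⊔_ (recip-* k₁ n₂) (recip-* k₂ n₁)) ⟩
    (recip k₁ * recip n₂) ⊔ (recip k₂ * recip n₁)   ∎
    where
    open ≡-Reasoning
    positive : ∀ {n n′} {H : PermSet n} {k} → IsIndex H k → 1 < n′ → 0 < k ℕ.* n′
    positive index 1<n′ = ℕP.*-mono-< (index-pos index) (ℕP.<-trans z<s 1<n′)

  different : recip k₁ * recip n₂ ≢ recip k₂ * recip n₁
  different e = *-cross-≢ k₂ coprime-degrees (index-pos index₁) (index-< index₁ i)
    (recip-injective (trans (sym (recip-* k₁ n₂)) (trans e (recip-* k₂ n₁))))
    where
    coprime-degrees : Coprime n₁ n₂
    coprime-degrees = coprime-∣ coprime (transitive⇒∣order G₁ transitive₁ i) (transitive⇒∣order G₂ transitive₂ j)
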